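{- Let $p$ be an odd prime. For $0\le i\le \frac{p-3}{2}$ and $0\le j\le p-1$ put $s_{ip+j}=(i+1)j \bmod p$, and let $S$ be the periodic sequence over $\mathbb{Z}_p$ with ring sequence $[s_0,s_1,\dots,s_{p(p-1)/2-1}]$. Then $S$ is an orientable sequence of order $2$ over $\mathbb{Z}_p$ of period $p(p-1)/2$, and no orientable sequence of order $2$ over $\mathbb{Z}_p$ has period greater than $p(p-1)/2$.
   Context: A ring sequence $[x_0,\dots,x_{m-1}]$ denotes the periodic sequence obtained by repeating $x_0,\dots,x_{m-1}$. For a periodic sequence $S=(s_i)$ of (least) period $m$ let $\mathbf{s}_n(i)=(s_i,\dots,s_{i+n-1})$, and for $\mathbf{u}=(u_0,\dots,u_{n-1})$ let $\mathbf{u}^R=(u_{n-1},\dots,u_0)$. $S$ is an orientable sequence of order $n$ if $\mathbf{s}_n(i)=\mathbf{s}_n(j)$ implies $i\equiv j\pmod m$, and $\mathbf{s}_n(i)\neq\mathbf{s}_n(j)^R$ for all $i,j$. -}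

module Defs where

open import Data.Nat using (ℕ; zero; suc; _+_; _*_; _<_; NonZero)
open import Data.Nat.DivMod using (_mod_)
open import Data.Nat.Primality using (Prime; prime⇒nonZero)
open import Data.Fin using (Fin; toℕ)
open import Data.Vec using (Vec; tabulate; reverse)
open import Data.Product using (_×_; ∃)
open import Relation.Binary.PropositionalEquality using (_≡_; _≢_)
open import Relation.Nullary using (¬_)

IsPeriod : ∀ {a} {A : Set a} → (ℕ → A) → ℕ → Set a
IsPeriod s m = ∀ i → s (i + m) ≡ s i

HasLeastPeriod : ∀ {a} {A : Set a} → (ℕ → A) → ℕ → Set a
HasLeastPeriod s m = (0 < m) × IsPeriod s m × (∀ k → 0 < k → k < m → ¬ IsPeriod s k)

_≡_[mod_] : ℕ → ℕ → ℕ → Set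
i ≡ j [mod m ] = ∃ λ a → ∃ λ b → i + a * m ≡ j + b * m

window : ∀ {a} {A : Set a} (n : ℕ) → (ℕ → A) → ℕ → Vec A n
window n s i = tabulate (λ k → s (i + toℕ k))

Orientable : ∀ {a} {A : Set a} (n : ℕ) → (ℕ → A) → ℕ → Set a
Orientable n s m =
  HasLeastPeriod s m ×
  (∀ i j → window n s i ≡ window n s j → i ≡ j [mod m ]) ×
  (∀ i j → window n s i ≢ reverse (window n s j))

entry : (p : ℕ) → Prime p → ℕ → ℕ → Fin p
entry p pp i j = ((suc i) * j) mod p
  where instance _ = prime⇒nonZero pp

{-# OPTIONS --safe #-}
module Submission where

-- Write positions as q M + (i p + j) with M = (k+1) p, row i ≤ k and column j < p.
-- Every step adds i + 1 modulo p, including the step from column p - 1 (value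
-- -(i+1)) to column 0 of the next row (value 0), so the window at (i, j) is
-- ((i+1) j, (i+1) (j+1)) mod p.  Its difference i + 1 < p recovers the row and then,
-- p being prime, its first entry recovers the column.  A reversed window from row i'
-- has difference -(i'+1), and 0 < (i+1) + (i'+1) < p.  For the bound, the m windows,
-- their m reversals and the p constant pairs are pairwise distinct elements of
-- ℤ_p × ℤ_p, so 2m + p ≤ p².

open import Defs
import Algebra.Properties.CommutativeSemigroup
open import Data.Fin using (Fin; toℕ)
open import Data.Fin.Properties using (toℕ<n; toℕ-injective; toℕ-fromℕ<; injective⇒≤; +↔⊎; *↔×)
open import Data.Nat using (ℕ; zero; suc; _+_; _*_; _∸_; _/_; _%_; _≤_; _<_; z≤n; s≤s; s≤s⁻¹; z<s; NonZero; >-nonZero; >-nonZero⁻¹)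
open import Data.Nat.DivMod using (m≡m%n+[m/n]*n; [m+kn]%n≡m%n; m%n%n≡m%n; m%n<n; m*n%n≡0; m<n⇒m%n≡m; m*n/n≡m; /-monoˡ-≤; m<n*o⇒m/o<n)
open import Data.Nat.Divisibility using (_∣_; divides; >⇒∤; m∣m*n)
open import Data.Nat.Primality using (Prime; euclidsLemma; prime⇒nonZero; prime⇒irreducible; ¬prime[1])
open import Data.Nat.Properties
open import Data.Nat.Tactic.RingSolver using (solve-∀)
open import Data.Product using (_×_; _,_; ∃; proj₁; proj₂; swap; map)
open import Data.Sum using (_⊎_; inj₁; inj₂)
open import Data.Sum.Function.Propositional using (_⊎-↔_)
open import Data.Vec using (Vec; _∷_; []; reverse)
open import Data.Vec.Properties using (tabulate-cong; reverse-injective; ∷-injectiveˡ)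
open import Function using (_∘_; Injective; _↣_; mk↣; Injection)
open import Function.Construct.Composition using (_↣-∘_; _↔-∘_)
open import Function.Properties.Inverse using (↔-refl; ↔-sym; ↔⇒↣)
open import Relation.Binary.PropositionalEquality using (_≡_; _≢_; refl; sym; trans; cong; cong₂; subst; subst₂; module ≡-Reasoning)
open import Relation.Nullary using (¬_; contradiction)

open ≡-Reasoning
open Algebra.Properties.CommutativeSemigroup +-commutativeSemigroup using (xy∙z≈xz∙y; xy∙z≈zx∙y; xy∙z≈zy∙x)

[m%d+n]%d≡[m+n]%d : ∀ m n d .{{_ : NonZero d}} → (m % d + n) % d ≡ (m + n) % d
[m%d+n]%d≡[m+n]%d m n d = begin
  (m % d + n) % d             ≡⟨ [m+kn]%n≡m%n (m % d + n) (m / d) d ⟨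
  (m % d + n + m / d * d) % d ≡⟨ cong (_% d) (xy∙z≈xz∙y (m % d) n (m / d * d)) ⟩
  (m % d + m / d * d + n) % d ≡⟨ cong (λ x → (x + n) % d) (m≡m%n+[m/n]*n m d) ⟨
  (m + n) % d                 ∎

[m+n]%d≡m%d⇒d∣n : ∀ m n d .{{_ : NonZero d}} → (m + n) % d ≡ m % d → d ∣ n
[m+n]%d≡m%d⇒d∣n m n d eq = divides ((r + n) / d) (+-cancelˡ-≡ r n _ r+n≡r+q*d)
  where
  r : ℕ
  r = m % d
  r+n≡r+q*d : r + n ≡ r + (r + n) / d * d
  r+n≡r+q*d = begin
    r + n                           ≡⟨ m≡m%n+[m/n]*n (r + n) d ⟩
    (r + n) % d + (r + n) / d * d   ≡⟨ cong (_+ (r + n) / d * d) ([m%d+n]%d≡[m+n]%d m n d) ⟩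
    (m + n) % d + (r + n) / d * d   ≡⟨ cong (_+ (r + n) / d * d) eq ⟩
    r + (r + n) / d * d             ∎

m∣n∧n<m⇒n≡0 : ∀ {m n} → m ∣ n → n < m → n ≡ 0
m∣n∧n<m⇒n≡0 {n = zero}  _   _   = refl
m∣n∧n<m⇒n≡0 {n = suc n} m∣n n<m = contradiction m∣n (>⇒∤ n<m)

d∣n∸m⇒m≡n : ∀ {d m n} → m ≤ n → n < d → d ∣ n ∸ m → m ≡ n
d∣n∸m⇒m≡n {m = m} {n} m≤n n<d d∣n∸m =
  ≤-antisym m≤n (m∸n≡0⇒m≤n (m∣n∧n<m⇒n≡0 d∣n∸m (≤-<-trans (m∸n≤m n m) n<d)))

+-%-cancelˡ-≤ : ∀ m {u v d} .{{_ : NonZero d}} →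
                u ≤ v → v < d → (m + u) % d ≡ (m + v) % d → u ≡ v
+-%-cancelˡ-≤ m {u} {v} {d} u≤v v<d eq = d∣n∸m⇒m≡n u≤v v<d d∣v∸u
  where
  d∣v∸u : d ∣ v ∸ u
  d∣v∸u = [m+n]%d≡m%d⇒d∣n (m + u) (v ∸ u) d (begin
    (m + u + (v ∸ u)) % d   ≡⟨ cong (_% d) (+-assoc m u (v ∸ u)) ⟩
    (m + (u + (v ∸ u))) % d ≡⟨ cong (λ x → (m + x) % d) (m+[n∸m]≡n u≤v) ⟩
    (m + v) % d             ≡⟨ eq ⟨
    (m + u) % d             ∎)

+-%-cancelˡ : ∀ m {u v d} .{{_ : NonZero d}} →
              u < d → v < d → (m + u) % d ≡ (m + v) % d → u ≡ v
+-%-cancelˡ m {u} {v} u<d v<d eq with ≤-total u v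
... | inj₁ u≤v = +-%-cancelˡ-≤ m u≤v v<d eq
... | inj₂ v≤u = sym (+-%-cancelˡ-≤ m v≤u u<d (sym eq))

*-%-cancelˡ-≤ : ∀ {c u v d} .{{_ : NonZero d}} → Prime d → 0 < c → c < d →
                u ≤ v → v < d → c * u % d ≡ c * v % d → u ≡ v
*-%-cancelˡ-≤ {c} {u} {v} {d} pd 0<c c<d u≤v v<d eq
  with euclidsLemma c (v ∸ u) pd d∣c*[v∸u]
  where
  d∣c*[v∸u] : d ∣ c * (v ∸ u)
  d∣c*[v∸u] = [m+n]%d≡m%d⇒d∣n (c * u) (c * (v ∸ u)) d (begin
    (c * u + c * (v ∸ u)) % d ≡⟨ cong (_% d) (*-distribˡ-+ c u (v ∸ u)) ⟨
    c * (u + (v ∸ u)) % d     ≡⟨ cong (λ x → c * x % d) (m+[n∸m]≡n u≤v) ⟩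
    c * v % d                 ≡⟨ eq ⟨
    c * u % d                 ∎)
... | inj₁ d∣c   = contradiction d∣c (>⇒∤ {{>-nonZero 0<c}} c<d)
... | inj₂ d∣v∸u = d∣n∸m⇒m≡n u≤v v<d d∣v∸u

*-%-cancelˡ : ∀ {c u v d} .{{_ : NonZero d}} → Prime d → 0 < c → c < d →
              u < d → v < d → c * u % d ≡ c * v % d → u ≡ v
*-%-cancelˡ {u = u} {v} pd 0<c c<d u<d v<d eq with ≤-total u v
... | inj₁ u≤v = *-%-cancelˡ-≤ pd 0<c c<d u≤v v<d eq
... | inj₂ v≤u = sym (*-%-cancelˡ-≤ pd 0<c c<d v≤u u<d (sym eq))

residue-pair : ∀ d .{{_ : NonZero d}} → ℕ → ℕ → ℕ × ℕ
residue-pair d a j = a * j % d , a * suc j % d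

module _ {d : ℕ} .{{_ : NonZero d}} where

  a[1+j]%d≡[aj%d+a]%d : ∀ a j → a * suc j % d ≡ (a * j % d + a) % d
  a[1+j]%d≡[aj%d+a]%d a j = begin
    a * suc j % d       ≡⟨ cong (_% d) (*-suc a j) ⟩
    (a + a * j) % d     ≡⟨ cong (_% d) (+-comm a (a * j)) ⟩
    (a * j + a) % d     ≡⟨ [m%d+n]%d≡[m+n]%d (a * j) a d ⟨
    (a * j % d + a) % d ∎

  residue-pair-injective : ∀ {a a' j j'} → Prime d → 0 < a → a < d → a' < d → j < d → j' < d →
                           residue-pair d a j ≡ residue-pair d a' j' → a ≡ a' × j ≡ j'
  residue-pair-injective {a} {a'} {j} {j'} pd 0<a a<d a'<d j<d j'<d eq = a≡a' , j≡j'
    where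
    aj≡a'j' : a * j % d ≡ a' * j' % d
    aj≡a'j' = cong proj₁ eq
    a≡a' : a ≡ a'
    a≡a' = +-%-cancelˡ (a * j % d) a<d a'<d (begin
      (a * j % d + a) % d   ≡⟨ a[1+j]%d≡[aj%d+a]%d a j ⟨
      a * suc j % d         ≡⟨ cong proj₂ eq ⟩
      a' * suc j' % d       ≡⟨ a[1+j]%d≡[aj%d+a]%d a' j' ⟩
      (a' * j' % d + a') % d ≡⟨ cong (λ x → (x + a') % d) aj≡a'j' ⟨
      (a * j % d + a') % d  ∎)
    j≡j' : j ≡ j'
    j≡j' = *-%-cancelˡ pd 0<a a<d j<d j'<d (subst (λ c → a * j % d ≡ c * j' % d) (sym a≡a') aj≡a'j')

  residue-pair-reversed : ∀ {a a' j j'} → residue-pair d a j ≡ swap (residue-pair d a' j') → d ∣ a + a'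
  residue-pair-reversed {a} {a'} {j} {j'} eq = [m+n]%d≡m%d⇒d∣n x (a + a') d (begin
    (x + (a + a')) % d       ≡⟨ cong (_% d) (+-assoc x a a') ⟨
    (x + a + a') % d         ≡⟨ [m%d+n]%d≡[m+n]%d (x + a) a' d ⟨
    ((x + a) % d + a') % d   ≡⟨ cong (λ y → (y + a') % d) (a[1+j]%d≡[aj%d+a]%d a j) ⟨
    (a * suc j % d + a') % d ≡⟨ cong (λ y → (y + a') % d) (cong proj₂ eq) ⟩
    (a' * j' % d + a') % d   ≡⟨ a[1+j]%d≡[aj%d+a]%d a' j' ⟨
    a' * suc j' % d          ≡⟨ cong proj₁ eq ⟨
    x                        ≡⟨ m%n%n≡m%n (a * j) d ⟨
    x % d                    ∎)
    where
    x : ℕ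
    x = a * j % d

≡[mod]⇒≡ : ∀ {i j m} → i < m → j < m → i ≡ j [mod m ] → i ≡ j
≡[mod]⇒≡ {i} {j} {m} i<m j<m (a , b , eq) = begin
  i               ≡⟨ m<n⇒m%n≡m i<m ⟨
  i % m           ≡⟨ [m+kn]%n≡m%n i a m ⟨
  (i + a * m) % m ≡⟨ cong (_% m) eq ⟩
  (j + b * m) % m ≡⟨ [m+kn]%n≡m%n j b m ⟩
  j % m           ≡⟨ m<n⇒m%n≡m j<m ⟩
  j               ∎
  where
  instance
    m≢0 : NonZero m
    m≢0 = >-nonZero (m<n⇒0<n i<m)

module _ {a} {A : Set a} where

  pair : Vec A 2 → A × A
  pair (x ∷ y ∷ []) = x , y

  pair-injective : Injective _≡_ _≡_ pair
  pair-injective {x ∷ y ∷ []} {.x ∷ .y ∷ []} refl = refl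

  pair-reverse : ∀ v → pair (reverse v) ≡ swap (pair v)
  pair-reverse (x ∷ y ∷ []) = refl

  pair-window : ∀ (s : ℕ → A) n → pair (window 2 s n) ≡ (s n , s (suc n))
  pair-window s n = cong₂ (λ i i' → s i , s i') (+-identityʳ n) (+-comm n 1)

  window-period : ∀ {s : ℕ → A} {t} n → IsPeriod s t → window n s t ≡ window n s 0
  window-period {s} {t} n per = tabulate-cong λ i → trans (cong s (+-comm t (toℕ i))) (per (toℕ i))

  distinct-windows⇒least-period : ∀ {s : ℕ → A} {m} n → 0 < m → IsPeriod s m →
    (∀ i j → window n s i ≡ window n s j → i ≡ j [mod m ]) → HasLeastPeriod s m
  distinct-windows⇒least-period {s} {m} n 0<m per distinct = 0<m , per , no-shorter-period
    where
    no-shorter-period : ∀ t → 0 < t → t < m → ¬ IsPeriod s t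
    no-shorter-period t 0<t t<m per-t =
      <-irrefl (sym (≡[mod]⇒≡ t<m 0<m (distinct t 0 (window-period n per-t)))) 0<t

module _ {a} {A : Set a} {T : ℕ → A} {m : ℕ}
         (distinct : ∀ i j → window 2 T i ≡ window 2 T j → i ≡ j [mod m ])
         (irreversible : ∀ i j → window 2 T i ≢ reverse (window 2 T j)) where

  windows-reversals-constants : Fin m ⊎ (Fin m ⊎ A) → Vec A 2
  windows-reversals-constants (inj₁ i)        = window 2 T (toℕ i)
  windows-reversals-constants (inj₂ (inj₁ i)) = reverse (window 2 T (toℕ i))
  windows-reversals-constants (inj₂ (inj₂ x)) = x ∷ x ∷ []

  private
    window-injective : ∀ {i j : Fin m} → window 2 T (toℕ i) ≡ window 2 T (toℕ j) → i ≡ j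
    window-injective eq = toℕ-injective (≡[mod]⇒≡ (toℕ<n _) (toℕ<n _) (distinct _ _ eq))

    window-nonconstant : ∀ n x → window 2 T n ≢ x ∷ x ∷ []
    window-nonconstant n x eq = irreversible n n (trans eq (cong reverse (sym eq)))

  windows-reversals-constants-injective : Injective _≡_ _≡_ windows-reversals-constants
  windows-reversals-constants-injective {inj₁ i} {inj₁ j} eq = cong inj₁ (window-injective eq)
  windows-reversals-constants-injective {inj₁ i} {inj₂ (inj₁ j)} eq = contradiction eq (irreversible _ _)
  windows-reversals-constants-injective {inj₁ i} {inj₂ (inj₂ x)} eq =
    contradiction eq (window-nonconstant _ x)
  windows-reversals-constants-injective {inj₂ (inj₁ i)} {inj₁ j} eq = contradiction (sym eq) (irreversible _ _)
  windows-reversals-constants-injective {inj₂ (inj₁ i)} {inj₂ (inj₁ j)} eq =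
    cong (inj₂ ∘ inj₁) (window-injective (reverse-injective eq))
  windows-reversals-constants-injective {inj₂ (inj₁ i)} {inj₂ (inj₂ x)} eq =
    contradiction (cong reverse eq) (window-nonconstant _ x)
  windows-reversals-constants-injective {inj₂ (inj₂ x)} {inj₁ j} eq =
    contradiction (sym eq) (window-nonconstant _ x)
  windows-reversals-constants-injective {inj₂ (inj₂ x)} {inj₂ (inj₁ j)} eq =
    contradiction (cong reverse (sym eq)) (window-nonconstant _ x)
  windows-reversals-constants-injective {inj₂ (inj₂ x)} {inj₂ (inj₂ y)} eq =
    cong (inj₂ ∘ inj₂) (∷-injectiveˡ eq)

m+[m+n]≤n*n⇒m≤n*[n∸1]/2 : ∀ m n → m + (m + n) ≤ n * n → m ≤ n * (n ∸ 1) / 2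
m+[m+n]≤n*n⇒m≤n*[n∸1]/2 m n le =
  subst (_≤ n * (n ∸ 1) / 2) (m*n/n≡m m 2) (/-monoˡ-≤ 2 m*2≤n*[n∸1])
  where
  m*2≤n*[n∸1] : m * 2 ≤ n * (n ∸ 1)
  m*2≤n*[n∸1] = subst₂ _≤_
    (sym (trans (*-comm m 2) (cong (m +_) (+-identityʳ m))))
    (trans (cong (n * n ∸_) (sym (*-identityʳ n))) (sym (*-distribˡ-∸ n n 1)))
    (m+n≤o⇒m≤o∸n (m + m) (subst (_≤ n * n) (sym (+-assoc m m n)) le))

orientable₂-period-bound : ∀ {p} (T : ℕ → Fin p) {m} → Orientable 2 T m → m ≤ p * (p ∸ 1) / 2
orientable₂-period-bound {p} T {m} (_ , distinct , irreversible) =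
  m+[m+n]≤n*n⇒m≤n*[n∸1]/2 m p (injective⇒≤ (Injection.injective encoding))
  where
  encoding : Fin (m + (m + p)) ↣ Fin (p * p)
  encoding = ↔⇒↣ (↔-sym *↔×)
         ↣-∘ (mk↣ pair-injective
         ↣-∘ (mk↣ (windows-reversals-constants-injective {T = T} distinct irreversible)
         ↣-∘ ↔⇒↣ ((↔-refl ⊎-↔ +↔⊎) ↔-∘ +↔⊎)))

module ArithmeticRows {p : ℕ} (pp : Prime p) (k : ℕ) (2[1+k]<p : suc k + suc k < p) where

  M : ℕ
  M = suc k * p

  private instance
    p≢0 : NonZero p
    p≢0 = prime⇒nonZero pp
    M≢0 : NonZero M
    M≢0 = m*n≢0 (suc k) p

  position : ℕ → ℕ → ℕ → ℕ
  position q i j = q * M + (i * p + j)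

  data Coordinates : ℕ → Set where
    at : ∀ q i j → i ≤ k → j < p → Coordinates (position q i j)

  coordinates : ∀ n → Coordinates n
  coordinates n = subst Coordinates (sym n≡) (at (n / M) (r / p) (r % p) r/p≤k (m%n<n r p))
    where
    r : ℕ
    r = n % M
    r/p≤k : r / p ≤ k
    r/p≤k = s≤s⁻¹ (m<n*o⇒m/o<n (m%n<n n M))
    n≡ : n ≡ position (n / M) (r / p) (r % p)
    n≡ = begin
      n                                ≡⟨ m≡m%n+[m/n]*n n M ⟩
      r + n / M * M                    ≡⟨ +-comm r _ ⟩
      n / M * M + r                    ≡⟨ cong (n / M * M +_) (m≡m%n+[m/n]*n r p) ⟩
      n / M * M + (r % p + r / p * p)  ≡⟨ cong (n / M * M +_) (+-comm (r % p) _) ⟩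
      position (n / M) (r / p) (r % p) ∎

  suc-position : ∀ q i j → suc (position q i j) ≡ position q i (suc j)
  suc-position q i j = sym (trans (cong (q * M +_) (+-suc (i * p) j)) (+-suc (q * M) (i * p + j)))

  1+i<p : ∀ {i} → i ≤ k → suc i < p
  1+i<p i≤k = ≤-<-trans (s≤s i≤k) (≤-<-trans (m≤m+n (suc k) (suc k)) 2[1+k]<p)

  module _ (S : ℕ → Fin p) (H : ∀ q i j → i ≤ k → j < p → S (position q i j) ≡ entry p pp i j) where

    value : ∀ q {i j} → i ≤ k → j < p → toℕ (S (position q i j)) ≡ suc i * j % p
    value q i≤k j<p = trans (cong toℕ (H q _ _ i≤k j<p)) (toℕ-fromℕ< _)

    value-row-start : ∀ q {i} → i ≤ k → toℕ (S (position q i 0)) ≡ 0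
    value-row-start q {i} i≤k = begin
      toℕ (S (position q i 0)) ≡⟨ value q i≤k (>-nonZero⁻¹ p) ⟩
      suc i * 0 % p            ≡⟨ cong (_% p) (*-zeroʳ (suc i)) ⟩
      0 % p                    ≡⟨ m<n⇒m%n≡m (>-nonZero⁻¹ p) ⟩
      0                        ∎

    value-row-end : ∀ q {i} → i ≤ k → toℕ (S (q * M + (i * p + p))) ≡ 0
    value-row-end q {i} i≤k with m≤n⇒m<n∨m≡n i≤k
    ... | inj₁ i<k = trans (cong (toℕ ∘ S) next-row) (value-row-start q i<k)
      where
      next-row : q * M + (i * p + p) ≡ position q (suc i) 0
      next-row = cong (q * M +_) (trans (+-comm (i * p) p) (sym (+-identityʳ _)))
    ... | inj₂ refl = trans (cong (toℕ ∘ S) next-block) (value-row-start (suc q) z≤n)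
      where
      next-block : q * M + (k * p + p) ≡ position (suc q) 0 0
      next-block = begin
        q * M + (k * p + p)  ≡⟨ cong (q * M +_) (+-comm (k * p) p) ⟩
        q * M + M            ≡⟨ +-comm (q * M) M ⟩
        suc q * M            ≡⟨ +-identityʳ _ ⟨
        position (suc q) 0 0 ∎

    value-next : ∀ q {i j} → i ≤ k → j < p → toℕ (S (suc (position q i j))) ≡ suc i * suc j % p
    value-next q {i} {j} i≤k j<p with m≤n⇒m<n∨m≡n j<p
    ... | inj₁ 1+j<p = trans (cong (toℕ ∘ S) (suc-position q i j)) (value q i≤k 1+j<p)
    ... | inj₂ 1+j≡p = begin
      toℕ (S (suc (position q i j)))   ≡⟨ cong (toℕ ∘ S) (suc-position q i j) ⟩
      toℕ (S (position q i (suc j)))   ≡⟨ cong (λ x → toℕ (S (q * M + (i * p + x)))) 1+j≡p ⟩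
      toℕ (S (q * M + (i * p + p)))    ≡⟨ value-row-end q i≤k ⟩
      0                                ≡⟨ m*n%n≡0 (suc i) p ⟨
      suc i * p % p                    ≡⟨ cong (λ x → suc i * x % p) 1+j≡p ⟨
      suc i * suc j % p                ∎

    residues : Vec (Fin p) 2 → ℕ × ℕ
    residues = map toℕ toℕ ∘ pair

    window-residues : ∀ q {i j} → i ≤ k → j < p →
                      residues (window 2 S (position q i j)) ≡ residue-pair p (suc i) j
    window-residues q i≤k j<p =
      trans (cong (map toℕ toℕ) (pair-window S _)) (cong₂ _,_ (value q i≤k j<p) (value-next q i≤k j<p))

    windows-distinct : ∀ n n' → window 2 S n ≡ window 2 S n' → n ≡ n' [mod M ]
    windows-distinct n n' eq with coordinates n | coordinates n'
    ... | at q i j i≤k j<p | at q' i' j' i'≤k j'<p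
      with refl , refl ← residue-pair-injective pp z<s (1+i<p i≤k) (1+i<p i'≤k) j<p j'<p (begin
        residue-pair p (suc i) j                   ≡⟨ window-residues q i≤k j<p ⟨
        residues (window 2 S (position q i j))     ≡⟨ cong residues eq ⟩
        residues (window 2 S (position q' i' j'))  ≡⟨ window-residues q' i'≤k j'<p ⟩
        residue-pair p (suc i') j'                 ∎)
      = q' , q , xy∙z≈zy∙x (q * M) (i * p + j) (q' * M)

    windows-irreversible : ∀ n n' → window 2 S n ≢ reverse (window 2 S n')
    windows-irreversible n n' eq with coordinates n | coordinates n'
    ... | at q i j i≤k j<p | at q' i' j' i'≤k j'<p =
      contradiction (residue-pair-reversed (begin
        residue-pair p (suc i) j                               ≡⟨ window-residues q i≤k j<p ⟨
        residues (window 2 S (position q i j))                 ≡⟨ cong residues eq ⟩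
        residues (reverse (window 2 S (position q' i' j')))    ≡⟨ cong (map toℕ toℕ) (pair-reverse _) ⟩
        swap (residues (window 2 S (position q' i' j')))       ≡⟨ cong swap (window-residues q' i'≤k j'<p) ⟩
        swap (residue-pair p (suc i') j')                      ∎))
        (>⇒∤ (≤-<-trans (+-mono-≤ (s≤s i≤k) (s≤s i'≤k)) 2[1+k]<p))

    period : IsPeriod S M
    period n with coordinates n
    ... | at q i j i≤k j<p = begin
      S (position q i j + M)   ≡⟨ cong S (xy∙z≈zx∙y (q * M) (i * p + j) M) ⟩
      S (position (suc q) i j) ≡⟨ H (suc q) i j i≤k j<p ⟩
      entry p pp i j           ≡⟨ H q i j i≤k j<p ⟨
      S (position q i j)       ∎

    orientable : Orientable 2 S M
    orientable =
      distinct-windows⇒least-period 2 (>-nonZero⁻¹ M) period windows-distinct ,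
      windows-distinct , windows-irreversible

arithmetic-rows-orientable : ∀ {p} (pp : Prime p) k → suc k + suc k < p → ∀ {M} → M ≡ suc k * p →
  (S : ℕ → Fin p) → (∀ q i j → i ≤ k → j < p → S (q * M + (i * p + j)) ≡ entry p pp i j) →
  Orientable 2 S M
arithmetic-rows-orientable pp k 2[1+k]<p refl = ArithmeticRows.orientable pp k 2[1+k]<p

even-or-odd : ∀ n → ∃ λ k → n ≡ 2 * k ⊎ n ≡ 1 + 2 * k
even-or-odd zero = 0 , inj₁ refl
even-or-odd (suc n) with even-or-odd n
... | k , inj₁ refl = k , inj₂ refl
... | k , inj₂ refl = suc k , inj₁ (sym (*-suc 2 k))

odd-prime⇒≡3+2k : ∀ {p} → Prime p → p ≢ 2 → ∃ λ k → p ≡ 3 + 2 * k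
odd-prime⇒≡3+2k {p} pp p≢2 with even-or-odd p
... | k , inj₁ refl with prime⇒irreducible pp (m∣m*n k)
...   | inj₂ 2≡p = contradiction (sym 2≡p) p≢2
odd-prime⇒≡3+2k pp p≢2 | zero , inj₂ refl = contradiction pp ¬prime[1]
odd-prime⇒≡3+2k pp p≢2 | suc k , inj₂ refl = k , cong suc (*-suc 2 k)

odd-prime⇒≡3+2[[p∸3]/2] : ∀ {p} → Prime p → p ≢ 2 → p ≡ 3 + 2 * ((p ∸ 3) / 2)
odd-prime⇒≡3+2[[p∸3]/2] pp p≢2 with odd-prime⇒≡3+2k pp p≢2
... | k , refl = cong (λ h → 3 + 2 * h) (sym (trans (cong (_/ 2) (*-comm 2 k)) (m*n/n≡m k 2)))

module _ {p : ℕ} (k : ℕ) (p≡3+2k : p ≡ 3 + 2 * k) where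

  p*[p∸1]/2≡[1+k]*p : p * (p ∸ 1) / 2 ≡ suc k * p
  p*[p∸1]/2≡[1+k]*p rewrite p≡3+2k =
    trans (cong (_/ 2) (p*[p∸1]≡[1+k]*p*2 k)) (m*n/n≡m (suc k * (3 + 2 * k)) 2)
    where
    p*[p∸1]≡[1+k]*p*2 : ∀ k → (3 + 2 * k) * (2 + 2 * k) ≡ suc k * (3 + 2 * k) * 2
    p*[p∸1]≡[1+k]*p*2 = solve-∀

  2[1+k]<p : suc k + suc k < p
  2[1+k]<p rewrite p≡3+2k = ≤-reflexive (1+2[1+k]≡p k)
    where
    1+2[1+k]≡p : ∀ k → suc (suc k + suc k) ≡ 3 + 2 * k
    1+2[1+k]≡p = solve-∀

theorem4 : (p : ℕ) → (pp : Prime p) → p ≢ 2 →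
    -- S is the periodic sequence with ring sequence [s_0, …, s_{p(p-1)/2-1}],
    -- where s_{ip+j} = (i+1) j mod p for 0 ≤ i ≤ (p-3)/2, 0 ≤ j ≤ p-1
    ((S : ℕ → Fin p) →
      (∀ q i j → i ≤ (p ∸ 3) / 2 → j < p →
        S (q * ((p * (p ∸ 1)) / 2) + (i * p + j)) ≡ entry p pp i j) →
      Orientable 2 S ((p * (p ∸ 1)) / 2))
    ×
    ((T : ℕ → Fin p) → (m : ℕ) → Orientable 2 T m → m ≤ (p * (p ∸ 1)) / 2)
theorem4 p pp p≢2 =
  arithmetic-rows-orientable pp k (2[1+k]<p k p≡3+2k) (p*[p∸1]/2≡[1+k]*p k p≡3+2k) ,
  λ T m → orientable₂-period-bound T
  where
  k : ℕ
  k = (p ∸ 3) / 2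
  p≡3+2k : p ≡ 3 + 2 * k
  p≡3+2k = odd-prime⇒≡3+2[[p∸3]/2] pp p≢2
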